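{- Let $(A,B)$ be a bimatrix game with $A,B\in\mathbb{Q}^{n\times n}$ and let $J\subseteq[n]$. For every row strategy $x$ there is a row strategy $\hat{x}$ such that (i) $S(\hat{x})$ contains at most one row from each $J$-equivalence class of rows, and (ii) $\hat{x}^TAy=x^TAy$ for every column strategy $y$ with $S(y)=J$. Symmetrically, for $I\subseteq[n]$ and every column strategy $y$ there is a column strategy $\hat{y}$ such that $S(\hat{y})$ contains at most one column from each $I$-equivalence class of columns and $x^TB\hat{y}=x^TBy$ for every row strategy $x$ with $S(x)=I$.
   Context: Bimatrix game: a row strategy is a probability vector $x$ over rows $[n]$, a column strategy a probability vector $y$ over columns $[n]$; payoffs $x^TAy$ (row player) and $x^TBy$ (column player). $S(x)=\{i:x_i>0\}$ is the support. For $I,J\subseteq[n]$, $A_{i,J}$ denotes the row vector of entries $A_{i,j}$, $j\in J$, and $B_{I,j}$ the column vector of entries $B_{i,j}$, $i\in I$. Two rows $i_1,i_2$ are $J$-equivalent if $A_{i_1,J}=A_{i_2,J}$; two columns $j_1,j_2$ are $I$-equivalent if $B_{I,j_1}=B_{I,j_2}$.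
   Formalization: All row and column strategies, including the given x and y, the test strategies with prescribed support, and $\hat{x}$, $\hat{y}$, have rational entries. -}

module Defs where

open import Data.Nat using (ℕ; zero; suc)
open import Data.Fin using (Fin; zero; suc)
open import Data.Fin.Subset using (Subset; _∈_)
open import Data.Rational using (ℚ; 0ℚ; 1ℚ; _+_; _*_; _≤_; _<_)
open import Data.Product using (_×_)
open import Relation.Binary.PropositionalEquality using (_≡_)

Matrix : ℕ → Set
Matrix n = Fin n → Fin n → ℚ

Vector : ℕ → Set
Vector n = Fin n → ℚ

∑ : ∀ {n} → (Fin n → ℚ) → ℚ
∑ {zero}  f = 0ℚ
∑ {suc n} f = f zero + ∑ (λ i → f (suc i))

IsStrategy : ∀ {n} → Vector n → Set
IsStrategy {n} x = (∀ i → 0ℚ ≤ x i) × (∑ x ≡ 1ℚ)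

InSupport : ∀ {n} → Vector n → Fin n → Set
InSupport x i = 0ℚ < x i

SupportIs : ∀ {n} → Vector n → Subset n → Set
SupportIs x I = ∀ i → (InSupport x i → i ∈ I) × (i ∈ I → InSupport x i)

payoff : ∀ {n} → Vector n → Matrix n → Vector n → ℚ
payoff x M y = ∑ (λ i → ∑ (λ j → x i * M i j * y j))

RowEquiv : ∀ {n} → Matrix n → Subset n → Fin n → Fin n → Set
RowEquiv A J i₁ i₂ = ∀ j → j ∈ J → A i₁ j ≡ A i₂ j

ColEquiv : ∀ {n} → Matrix n → Subset n → Fin n → Fin n → Set
ColEquiv B I j₁ j₂ = ∀ i → i ∈ I → B i j₁ ≡ B i j₂

AtMostOnePerClass : ∀ {n} → (Fin n → Fin n → Set) → Vector n → Set
AtMostOnePerClass E x =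
  ∀ i₁ i₂ → InSupport x i₁ → InSupport x i₂ → E i₁ i₂ → i₁ ≡ i₂

-- Let E be a decidable equivalence relation on the rows [n] and
-- let r : [n] → [n] pick a canonical representative of every E-class.
-- Pushing a strategy x forward along r (moving the whole mass of every
-- class onto its representative) gives a strategy x̂ whose support
-- consists of representatives only, hence meets every class at most
-- once, and which satisfies  ∑ᵢ x̂ᵢ gᵢ = ∑ₖ xₖ g(r k) = ∑ₖ xₖ gₖ  for every
-- g that is constant on E-classes.  If S(y) = J, the payoff vector
-- gᵢ = (Ay)ᵢ is constant on J-equivalence classes of rows, because
-- yⱼ = 0 off J; so x̂ᵀAy = xᵀAy.  The statement for columns is the
-- statement for rows applied to Bᵀ, since I-equivalence of columns of B
-- is literally I-equivalence of rows of Bᵀ and xᵀBy = yᵀBᵀx.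
module Submission where

open import Defs
open import Data.Nat using (ℕ; zero; suc)
open import Data.Fin using (Fin; zero; suc)
open import Data.Fin.Subset using (Subset; _∈_)
open import Data.Fin.Subset.Properties using (_∈?_)
open import Data.Fin.Properties using (all?) renaming (_≟_ to _≟ᶠ_)
open import Data.Product using (Σ; _×_; _,_; proj₁)
open import Data.Rational using (ℚ; 0ℚ; 1ℚ; _+_; _*_; _≤_)
open import Data.Rational.Properties
open import Algebra.Bundles using (CommutativeRing)
open import Relation.Binary.Core using (Rel)
open import Relation.Binary.Structures using (IsDecEquivalence)
import Relation.Binary.Construct.On as On
import Algebra.Properties.Semiring.Sum
open import Relation.Nullary using (yes; no; ¬_)
open import Relation.Nullary.Decidable.Core using (_→-dec_)
open import Data.Empty using (⊥-elim)
open import Relation.Binary.PropositionalEquality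

open ≡-Reasoning

module Lib = Algebra.Properties.Semiring.Sum
  (CommutativeRing.semiring +-*-commutativeRing)

∑≡sum : ∀ {n} (f : Fin n → ℚ) → ∑ f ≡ Lib.sum f
∑≡sum {zero}  f = refl
∑≡sum {suc n} f = cong (f zero +_) (∑≡sum (λ i → f (suc i)))

∑-cong : ∀ {n} {f g : Fin n → ℚ} → (∀ i → f i ≡ g i) → ∑ f ≡ ∑ g
∑-cong {f = f} {g} f≗g =
  trans (∑≡sum f) (trans (Lib.sum-cong-≗ f≗g) (sym (∑≡sum g)))

∑-zero : ∀ n → ∑ {n} (λ _ → 0ℚ) ≡ 0ℚ
∑-zero n = trans (∑≡sum {n} (λ _ → 0ℚ)) (Lib.sum-replicate-zero n)

∑-*ˡ : ∀ {n} (c : ℚ) (f : Fin n → ℚ) → ∑ (λ i → c * f i) ≡ c * ∑ f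
∑-*ˡ c f = begin
  ∑ (λ i → c * f i)  ≡⟨ ∑≡sum (λ i → c * f i) ⟩
  Lib.sum (λ i → c * f i)  ≡⟨ sym (Lib.*-distribˡ-sum c f) ⟩
  c * Lib.sum f  ≡⟨ cong (c *_) (sym (∑≡sum f)) ⟩
  c * ∑ f  ∎

∑-*ʳ : ∀ {n} (c : ℚ) (f : Fin n → ℚ) → ∑ (λ i → f i * c) ≡ ∑ f * c
∑-*ʳ c f = begin
  ∑ (λ i → f i * c)  ≡⟨ ∑-cong (λ i → *-comm (f i) c) ⟩
  ∑ (λ i → c * f i)  ≡⟨ ∑-*ˡ c f ⟩
  c * ∑ f  ≡⟨ *-comm c (∑ f) ⟩
  ∑ f * c  ∎

∑-comm : ∀ {m n} (f : Fin m → Fin n → ℚ) →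
  ∑ (λ i → ∑ (λ j → f i j)) ≡ ∑ (λ j → ∑ (λ i → f i j))
∑-comm f = begin
  ∑ (λ i → ∑ (f i))  ≡⟨ ∑-cong (λ i → ∑≡sum (f i)) ⟩
  ∑ (λ i → Lib.sum (f i))  ≡⟨ ∑≡sum (λ i → Lib.sum (f i)) ⟩
  Lib.sum (λ i → Lib.sum (f i))  ≡⟨ Lib.∑-comm f ⟩
  Lib.sum (λ j → Lib.sum (λ i → f i j))  ≡⟨ sym (∑≡sum (λ j → Lib.sum (λ i → f i j))) ⟩
  ∑ (λ j → Lib.sum (λ i → f i j))  ≡⟨ sym (∑-cong (λ j → ∑≡sum (λ i → f i j))) ⟩
  ∑ (λ j → ∑ (λ i → f i j))  ∎

∑-nonneg : ∀ {n} (f : Fin n → ℚ) → (∀ i → 0ℚ ≤ f i) → 0ℚ ≤ ∑ f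
∑-nonneg {zero}  f f≥0 = ≤-refl
∑-nonneg {suc n} f f≥0 =
  subst (_≤ ∑ f) (+-identityʳ 0ℚ)
    (+-mono-≤ (f≥0 zero) (∑-nonneg (λ i → f (suc i)) (λ i → f≥0 (suc i))))

δ : ∀ {n} → Fin n → Fin n → ℚ
δ zero    zero    = 1ℚ
δ zero    (suc _) = 0ℚ
δ (suc _) zero    = 0ℚ
δ (suc a) (suc i) = δ a i

∑-δ : ∀ {n} (a : Fin n) (g : Fin n → ℚ) → ∑ (λ i → δ a i * g i) ≡ g a
∑-δ {suc n} zero g = begin
  1ℚ * g zero + ∑ (λ i → 0ℚ * g (suc i))
    ≡⟨ cong₂ _+_ (*-identityˡ (g zero))
                 (trans (∑-cong (λ i → *-zeroˡ (g (suc i)))) (∑-zero n)) ⟩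
  g zero + 0ℚ  ≡⟨ +-identityʳ (g zero) ⟩
  g zero  ∎
∑-δ {suc n} (suc a) g =
  trans (cong₂ _+_ (*-zeroˡ (g zero)) (∑-δ a (λ i → g (suc i))))
        (+-identityˡ (g (suc a)))

δ-≢ : ∀ {n} (a i : Fin n) → a ≢ i → δ a i ≡ 0ℚ
δ-≢ zero    zero    a≢i = ⊥-elim (a≢i refl)
δ-≢ zero    (suc i) a≢i = refl
δ-≢ (suc a) zero    a≢i = refl
δ-≢ (suc a) (suc i) a≢i = δ-≢ a i (λ a≡i → a≢i (cong suc a≡i))

δ-*-nonneg : ∀ {n} (a i : Fin n) {v : ℚ} → 0ℚ ≤ v → 0ℚ ≤ δ a i * v
δ-*-nonneg zero    zero    {v} v≥0 = subst (0ℚ ≤_) (sym (*-identityˡ v)) v≥0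
δ-*-nonneg zero    (suc i) {v} v≥0 = subst (0ℚ ≤_) (sym (*-zeroˡ v)) ≤-refl
δ-*-nonneg (suc a) zero    {v} v≥0 = subst (0ℚ ≤_) (sym (*-zeroˡ v)) ≤-refl
δ-*-nonneg (suc a) (suc i)     v≥0 = δ-*-nonneg a i v≥0

-- rep i is the first element (in the order of Fin n) of the class of i.
rep : ∀ {n ℓ} {E : Rel (Fin n) ℓ} → IsDecEquivalence E → Fin n → Fin n
rep eq zero = zero
rep eq (suc i) with IsDecEquivalence._≟_ eq zero (suc i)
... | yes _ = zero
... | no  _ = suc (rep (On.isDecEquivalence suc eq) i)

rep-related : ∀ {n ℓ} {E : Rel (Fin n) ℓ} (eq : IsDecEquivalence E) i →
  E (rep eq i) i
rep-related eq zero = IsDecEquivalence.refl eq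
rep-related eq (suc i) with IsDecEquivalence._≟_ eq zero (suc i)
... | yes E0i = E0i
... | no  _   = rep-related (On.isDecEquivalence suc eq) i

rep-cong : ∀ {n ℓ} {E : Rel (Fin n) ℓ} (eq : IsDecEquivalence E) {i j} →
  E i j → rep eq i ≡ rep eq j
rep-cong eq {zero}  {zero}  Eij = refl
rep-cong eq {zero}  {suc j} Eij with IsDecEquivalence._≟_ eq zero (suc j)
... | yes _   = refl
... | no ¬E0j = ⊥-elim (¬E0j Eij)
rep-cong eq {suc i} {zero}  Eij with IsDecEquivalence._≟_ eq zero (suc i)
... | yes _   = refl
... | no ¬E0i = ⊥-elim (¬E0i (IsDecEquivalence.sym eq Eij))
rep-cong eq {suc i} {suc j} Eij
  with IsDecEquivalence._≟_ eq zero (suc i) | IsDecEquivalence._≟_ eq zero (suc j)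
... | yes _   | yes _   = refl
... | yes E0i | no ¬E0j = ⊥-elim (¬E0j (IsDecEquivalence.trans eq E0i Eij))
... | no ¬E0i | yes E0j =
  ⊥-elim (¬E0i (IsDecEquivalence.trans eq E0j (IsDecEquivalence.sym eq Eij)))
... | no _    | no _    = cong suc (rep-cong (On.isDecEquivalence suc eq) Eij)

rep-idempotent : ∀ {n ℓ} {E : Rel (Fin n) ℓ} (eq : IsDecEquivalence E) i →
  rep eq (rep eq i) ≡ rep eq i
rep-idempotent eq i = rep-cong eq (rep-related eq i)

-- (push r x)ᵢ is the total weight of x on the fibre r⁻¹(i).
push : ∀ {n} → (Fin n → Fin n) → Vector n → Vector n
push r x i = ∑ (λ k → δ (r k) i * x k)

∑-push : ∀ {n} (r : Fin n → Fin n) (x : Vector n) (g : Fin n → ℚ) →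
  ∑ (λ i → push r x i * g i) ≡ ∑ (λ k → x k * g (r k))
∑-push r x g = begin
  ∑ (λ i → push r x i * g i)
    ≡⟨ ∑-cong (λ i → sym (∑-*ʳ (g i) (λ k → δ (r k) i * x k))) ⟩
  ∑ (λ i → ∑ (λ k → δ (r k) i * x k * g i))
    ≡⟨ ∑-comm (λ i k → δ (r k) i * x k * g i) ⟩
  ∑ (λ k → ∑ (λ i → δ (r k) i * x k * g i))
    ≡⟨ ∑-cong (λ k → ∑-cong (λ i → swap-factor (δ (r k) i) (x k) (g i))) ⟩
  ∑ (λ k → ∑ (λ i → x k * (δ (r k) i * g i)))
    ≡⟨ ∑-cong (λ k → trans (∑-*ˡ (x k) (λ i → δ (r k) i * g i))
                           (cong (x k *_) (∑-δ (r k) g))) ⟩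
  ∑ (λ k → x k * g (r k))  ∎
  where
  swap-factor : ∀ d v w → d * v * w ≡ v * (d * w)
  swap-factor d v w = trans (cong (_* w) (*-comm d v)) (*-assoc v d w)

push-strategy : ∀ {n} (r : Fin n → Fin n) (x : Vector n) →
  IsStrategy x → IsStrategy (push r x)
push-strategy r x (x≥0 , ∑x≡1) =
    (λ i → ∑-nonneg (λ k → δ (r k) i * x k) (λ k → δ-*-nonneg (r k) i (x≥0 k)))
  , (begin
      ∑ (push r x)                      ≡⟨ ∑-cong (λ i → sym (*-identityʳ (push r x i))) ⟩
      ∑ (λ i → push r x i * 1ℚ)         ≡⟨ ∑-push r x (λ _ → 1ℚ) ⟩
      ∑ (λ k → x k * 1ℚ)                ≡⟨ ∑-cong (λ k → *-identityʳ (x k)) ⟩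
      ∑ x                               ≡⟨ ∑x≡1 ⟩
      1ℚ                                ∎)

-- For idempotent r, the push-forward is supported on fixed points of r:
-- if r i ≢ i then no k is mapped to i, so the fibre of i is empty.
push-support : ∀ {n} (r : Fin n → Fin n) → (∀ k → r (r k) ≡ r k) →
  (x : Vector n) → ∀ i → InSupport (push r x) i → r i ≡ i
push-support {n} r r-idem x i i∈S with r i ≟ᶠ i
... | yes ri≡i = ri≡i
... | no  ri≢i = ⊥-elim (<-irrefl (sym push≡0) i∈S)
  where
  not-hit : ∀ k → r k ≢ i
  not-hit k rk≡i = ri≢i (begin
    r i      ≡⟨ cong r (sym rk≡i) ⟩
    r (r k)  ≡⟨ r-idem k ⟩
    r k      ≡⟨ rk≡i ⟩
    i        ∎)

  push≡0 : push r x i ≡ 0ℚ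
  push≡0 = trans (∑-cong (λ k → trans (cong (_* x k) (δ-≢ (r k) i (not-hit k)))
                                      (*-zeroˡ (x k))))
                 (∑-zero n)

collapse : ∀ {n} {E : Fin n → Fin n → Set} → IsDecEquivalence E →
  (x : Vector n) → IsStrategy x →
  Σ (Vector n) λ x̂ → IsStrategy x̂ × AtMostOnePerClass E x̂
    × ((g : Fin n → ℚ) → (∀ {i j} → E i j → g i ≡ g j)
       → ∑ (λ i → x̂ i * g i) ≡ ∑ (λ i → x i * g i))
collapse {n} {E} eq x x-strat =
  push r x , push-strategy r x x-strat , one-per-class , preserves
  where
  r : Fin n → Fin n
  r = rep eq

  fixed : ∀ i → InSupport (push r x) i → r i ≡ i
  fixed = push-support r (rep-idempotent eq) x

  one-per-class : AtMostOnePerClass E (push r x)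
  one-per-class i₁ i₂ i₁∈S i₂∈S Ei₁i₂ = begin
    i₁    ≡⟨ sym (fixed i₁ i₁∈S) ⟩
    r i₁  ≡⟨ rep-cong eq Ei₁i₂ ⟩
    r i₂  ≡⟨ fixed i₂ i₂∈S ⟩
    i₂    ∎

  preserves : (g : Fin n → ℚ) → (∀ {i j} → E i j → g i ≡ g j)
    → ∑ (λ i → push r x i * g i) ≡ ∑ (λ i → x i * g i)
  preserves g g-const = trans (∑-push r x g)
    (∑-cong (λ k → cong (x k *_) (g-const (rep-related eq k))))

rowPayoff : ∀ {n} → Matrix n → Vector n → Fin n → ℚ
rowPayoff A y i = ∑ (λ j → A i j * y j)

payoff-rows : ∀ {n} (x : Vector n) (A : Matrix n) (y : Vector n) →
  payoff x A y ≡ ∑ (λ i → x i * rowPayoff A y i)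
payoff-rows x A y = ∑-cong (λ i →
  trans (∑-cong (λ j → *-assoc (x i) (A i j) (y j)))
        (∑-*ˡ (x i) (λ j → A i j * y j)))

transpose : ∀ {n} → Matrix n → Matrix n
transpose M i j = M j i

payoff-transpose : ∀ {n} (x : Vector n) (M : Matrix n) (y : Vector n) →
  payoff x M y ≡ payoff y (transpose M) x
payoff-transpose x M y =
  trans (∑-comm (λ i j → x i * M i j * y j))
        (∑-cong (λ j → ∑-cong (λ i → reverse (x i) (M i j) (y j))))
  where
  reverse : ∀ a m b → a * m * b ≡ b * m * a
  reverse a m b = begin
    a * m * b    ≡⟨ *-comm (a * m) b ⟩
    b * (a * m)  ≡⟨ cong (b *_) (*-comm a m) ⟩
    b * (m * a)  ≡⟨ sym (*-assoc b m a) ⟩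
    b * m * a    ∎

outside-support : ∀ {n} (y : Vector n) (J : Subset n) →
  (∀ j → 0ℚ ≤ y j) → SupportIs y J → ∀ j → ¬ j ∈ J → y j ≡ 0ℚ
outside-support y J y≥0 S≡J j j∉J =
  ≤-antisym (≮⇒≥ (λ j∈S → j∉J (proj₁ (S≡J j) j∈S))) (y≥0 j)

rowPayoff-const : ∀ {n} (A : Matrix n) (J : Subset n) (y : Vector n) →
  IsStrategy y → SupportIs y J →
  ∀ {i₁ i₂} → RowEquiv A J i₁ i₂ → rowPayoff A y i₁ ≡ rowPayoff A y i₂
rowPayoff-const A J y (y≥0 , _) S≡J {i₁} {i₂} A₁≡A₂ = ∑-cong termwise
  where
  termwise : ∀ j → A i₁ j * y j ≡ A i₂ j * y j
  termwise j with j ∈? J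
  ... | yes j∈J = cong (_* y j) (A₁≡A₂ j j∈J)
  ... | no  j∉J rewrite outside-support y J y≥0 S≡J j j∉J =
    trans (*-zeroʳ (A i₁ j)) (sym (*-zeroʳ (A i₂ j)))

rowEquiv-isDecEquivalence : ∀ {n} (A : Matrix n) (J : Subset n) →
  IsDecEquivalence (RowEquiv A J)
rowEquiv-isDecEquivalence A J = record
  { isEquivalence = record
    { refl  = λ _ _ → refl
    ; sym   = λ A₁≡A₂ j j∈J → sym (A₁≡A₂ j j∈J)
    ; trans = λ A₁≡A₂ A₂≡A₃ j j∈J → trans (A₁≡A₂ j j∈J) (A₂≡A₃ j j∈J)
    }
  ; _≟_ = λ i₁ i₂ → all? (λ j → (j ∈? J) →-dec (A i₁ j ≟ A i₂ j))
  }

rowReduction : ∀ {n} (A : Matrix n) (J : Subset n) (x : Vector n) →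
  IsStrategy x →
  Σ (Vector n) λ x̂ → IsStrategy x̂
    × AtMostOnePerClass (RowEquiv A J) x̂
    × ((y : Vector n) → IsStrategy y → SupportIs y J
       → payoff x̂ A y ≡ payoff x A y)
rowReduction A J x x-strat
  with collapse (rowEquiv-isDecEquivalence A J) x x-strat
... | x̂ , x̂-strat , one-per-class , preserves =
  x̂ , x̂-strat , one-per-class , λ y y-strat S≡J → begin
    payoff x̂ A y                      ≡⟨ payoff-rows x̂ A y ⟩
    ∑ (λ i → x̂ i * rowPayoff A y i)   ≡⟨ preserves (rowPayoff A y)
                                          (rowPayoff-const A J y y-strat S≡J) ⟩
    ∑ (λ i → x i * rowPayoff A y i)   ≡⟨ sym (payoff-rows x A y) ⟩
    payoff x A y                      ∎

-- The column half: columns of B are the rows of Bᵀ, and ColEquiv B I is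
-- by definition RowEquiv (transpose B) I.
columnReduction : ∀ {n} (B : Matrix n) (I : Subset n) (y : Vector n) →
  IsStrategy y →
  Σ (Vector n) λ ŷ → IsStrategy ŷ
    × AtMostOnePerClass (ColEquiv B I) ŷ
    × ((x : Vector n) → IsStrategy x → SupportIs x I
       → payoff x B ŷ ≡ payoff x B y)
columnReduction B I y y-strat with rowReduction (transpose B) I y y-strat
... | ŷ , ŷ-strat , one-per-class , preserves =
  ŷ , ŷ-strat , one-per-class , λ x x-strat S≡I → begin
    payoff x B ŷ              ≡⟨ payoff-transpose x B ŷ ⟩
    payoff ŷ (transpose B) x  ≡⟨ preserves x x-strat S≡I ⟩
    payoff y (transpose B) x  ≡⟨ sym (payoff-transpose x B y) ⟩
    payoff x B y              ∎

lemma7 : (n : ℕ) (A B : Matrix n)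
    → ((J : Subset n) (x : Vector n) → IsStrategy x
        → Σ (Vector n) λ x̂ → IsStrategy x̂
            × AtMostOnePerClass (RowEquiv A J) x̂
            × ((y : Vector n) → IsStrategy y → SupportIs y J
                → payoff x̂ A y ≡ payoff x A y))
    × ((I : Subset n) (y : Vector n) → IsStrategy y
        → Σ (Vector n) λ ŷ → IsStrategy ŷ
            × AtMostOnePerClass (ColEquiv B I) ŷ
            × ((x : Vector n) → IsStrategy x → SupportIs x I
                → payoff x B ŷ ≡ payoff x B y))
lemma7 n A B = rowReduction A , columnReduction B
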